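{- For every $m\ge 0$ the following three sets are in bijection: (i) the set of rooted bicolored chord diagrams with $m$ chords; (ii) the set of bicolored ordered matchings of size $2m$; (iii) the set of (isomorphism classes of) pairs $(\mathcal M_\bullet,S)$ where $\mathcal M_\bullet$ is a rooted map with $m$ edges and $S$ is a quasi-tree of $\mathcal M_\bullet$.
   Context: A map is a triple $\mathcal M=(B,\sigma,\alpha)$ with $B$ a finite set (of flags), $\sigma,\alpha\in\mathrm{Sym}(B)$, $\alpha$ a fixed-point-free involution, $\langle\sigma,\alpha\rangle$ transitive on $B$; permutations compose as functions. Edges are the cycles of $\alpha$; $\underline b=\{b,\alpha(b)\}$. The tour of a set $F$ of edges is $\tau$ with $\tau(b)=\sigma\alpha(b)$ if $\underline b\in F$, $\tau(b)=\sigma(b)$ otherwise; a quasi-tree is a set of edges whose tour is a single cycle on $B$. A rooted map is a pair $\mathcal M_\bullet=(\mathcal M,b_\bullet)$ with $b_\bullet\in B$; $(\mathcal M,b_\bullet)$ and $(\mathcal M',b'_\bullet)$ are isomorphic if there is a bijection $f:B\to B'$ with $\sigma'=f\sigma f^{ -1}$, $\alpha'=f\alpha f^{ -1}$, $f(b_\bullet)=b'_\bullet$; pairs $(\mathcal M_\bullet,S)$ are isomorphic if such an $f$ also maps $S$ onto $S'$. A chord diagram with $m$ chords is a set of $2m$ points on a circle partitioned into $m$ pairs (chords), considered up to orientation-preserving homeomorphism of the circle; it is bicolored if each chord receives color 1 or 2, and rooted if one chord endpoint is distinguished. A bicolored ordered matching of size $2m$ is a perfect matching of $\{1,\dots,2m\}$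 with each matched pair colored 1 or 2. -}

module Defs where

open import Level using (0ℓ)
open import Data.Nat using (ℕ; zero; suc; _*_)
open import Data.Nat.DivMod using (_mod_)
open import Data.Fin using (Fin; toℕ)
open import Data.Bool using (Bool; true; false; if_then_else_)
open import Data.Unit using (⊤; tt)
open import Data.Product using (Σ; ∃; _×_; _,_; proj₁; proj₂)
open import Function using (_∘_)
open import Relation.Binary.PropositionalEquality
  using (_≡_; _≢_; refl; sym; trans; cong)
open import Relation.Binary.Bundles using (Setoid)
open import Data.Fin.Permutation
  using (Permutation′; _⟨$⟩ʳ_; _⟨$⟩ˡ_; inverseˡ; inverseʳ; flip; _∘ₚ_)
  renaming (id to idₚ)

iter : {A : Set} → (A → A) → ℕ → A → A
iter f zero    a = a
iter f (suc k) a = f (iter f k a)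

-- cyclic successor on Fin n (points 0,1,…,n-1 placed in this order
-- counter-clockwise around a circle)
next : {n : ℕ} → Fin n → Fin n
next {suc n} i = suc (toℕ i) mod suc n

-- Type of possible roots on a set of n flags / points.  For n = 0 there
-- is no point to distinguish; by the usual convention the (unique) empty
-- object counts as rooted.
Pt : ℕ → Set
Pt zero    = ⊤
Pt (suc n) = Fin (suc n)

RootRel : {n : ℕ} → (Fin n → Fin n) → Pt n → Pt n → Set
RootRel {zero}  f r r' = ⊤
RootRel {suc n} f r r' = f r ≡ r'

Commutes : {n : ℕ} → Permutation′ n → (Fin n → Fin n) → (Fin n → Fin n) → Set
Commutes f g g' = ∀ i → g' (f ⟨$⟩ʳ i) ≡ f ⟨$⟩ʳ (g i)

Transports : {n : ℕ} {A : Set} → Permutation′ n → (Fin n → A) → (Fin n → A) → Set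
Transports f c c' = ∀ i → c' (f ⟨$⟩ʳ i) ≡ c i

module _ {n : ℕ} where
  com-refl : (g : Fin n → Fin n) → Commutes idₚ g g
  com-refl g i = refl

  com-sym : (f : Permutation′ n) (g g' : Fin n → Fin n) →
            Commutes f g g' → Commutes (flip f) g' g
  com-sym f g g' c j =
    trans (sym (inverseˡ f))
      (cong (f ⟨$⟩ˡ_) (trans (sym (c (f ⟨$⟩ˡ j))) (cong g' (inverseʳ f))))

  com-trans : (f h : Permutation′ n) (g g' g'' : Fin n → Fin n) →
              Commutes f g g' → Commutes h g' g'' → Commutes (f ∘ₚ h) g g''
  com-trans f h g g' g'' c d i = trans (d (f ⟨$⟩ʳ i)) (cong (h ⟨$⟩ʳ_) (c i))

  tr-refl : {A : Set} (c : Fin n → A) → Transports idₚ c c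
  tr-refl c i = refl

  tr-sym : {A : Set} (f : Permutation′ n) (c c' : Fin n → A) →
           Transports f c c' → Transports (flip f) c' c
  tr-sym f c c' t j = trans (sym (t (f ⟨$⟩ˡ j))) (cong c' (inverseʳ f))

  tr-trans : {A : Set} (f h : Permutation′ n) (c c' c'' : Fin n → A) →
             Transports f c c' → Transports h c' c'' → Transports (f ∘ₚ h) c c''
  tr-trans f h c c' c'' t u i = trans (u (f ⟨$⟩ʳ i)) (t i)

root-refl : {n : ℕ} (r : Pt n) → RootRel (idₚ {n} ⟨$⟩ʳ_) r r
root-refl {zero}  r = tt
root-refl {suc n} r = refl

root-sym : {n : ℕ} (f : Permutation′ n) (r r' : Pt n) →
           RootRel (f ⟨$⟩ʳ_) r r' → RootRel (flip f ⟨$⟩ʳ_) r' r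
root-sym {zero}  f r r' p = tt
root-sym {suc n} f r r' p = trans (cong (f ⟨$⟩ˡ_) (sym p)) (inverseˡ f)

root-trans : {n : ℕ} (f h : Permutation′ n) (r r' r'' : Pt n) →
             RootRel (f ⟨$⟩ʳ_) r r' → RootRel (h ⟨$⟩ʳ_) r' r'' →
             RootRel ((f ∘ₚ h) ⟨$⟩ʳ_) r r''
root-trans {zero}  f h r r' r'' p q = tt
root-trans {suc n} f h r r' r'' p q = trans (cong (h ⟨$⟩ʳ_) p) q

Colour : Set
Colour = Fin 2

-- Bicoloured perfect matchings of the point set Fin n.
-- `pair` is the fixed-point-free involution matching the points; the
-- colour of a chord (matched pair) is recorded on both of its endpoints.

record BMatching (n : ℕ) : Set where
  field
    pair       : Fin n → Fin n
    pair-invol : ∀ i → pair (pair i) ≡ i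
    pair-fpf   : ∀ i → pair i ≢ i
    colour     : Fin n → Colour
    colour-chord : ∀ i → colour (pair i) ≡ colour i
open BMatching public

-- (ii) Bicoloured ordered matchings of size 2m of {1,…,2m}
-- (here {0,…,2m-1}); two are equal iff they have the same pairs with
-- the same colours.

BOM-Setoid : ℕ → Setoid 0ℓ 0ℓ
BOM-Setoid m = record
  { Carrier = BMatching (2 * m)
  ; _≈_ = λ M N → (∀ i → pair M i ≡ pair N i) × (∀ i → colour M i ≡ colour N i)
  ; isEquivalence = record
    { refl  = (λ i → refl) , (λ i → refl)
    ; sym   = λ (p , c) → (λ i → sym (p i)) , (λ i → sym (c i))
    ; trans = λ (p , c) (q , d) → (λ i → trans (p i) (q i)) , (λ i → trans (c i) (d i))
    }
  }

-- A representative is a bicoloured matching of 2m points placed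
-- cyclically (in the order given by `next`) on the circle, together with
-- a distinguished point (root).  Two representatives give the same
-- chord diagram iff some bijection of the points preserving the cyclic
-- order (i.e. induced by an orientation-preserving homeomorphism of the
-- circle, i.e. commuting with `next`) maps chords to chords, colours to
-- colours and root to root.

record RBCD (n : ℕ) : Set where
  field
    diagram : BMatching n
    root    : Pt n
open RBCD public

RBCD-Iso : {n : ℕ} → RBCD n → RBCD n → Set
RBCD-Iso {n} D E = Σ (Permutation′ n) λ f →
  Commutes f next next ×
  Commutes f (pair (diagram D)) (pair (diagram E)) ×
  Transports f (colour (diagram D)) (colour (diagram E)) ×
  RootRel (f ⟨$⟩ʳ_) (root D) (root E)

RBCD-Setoid : ℕ → Setoid 0ℓ 0ℓ
RBCD-Setoid m = record
  { Carrier = RBCD (2 * m)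
  ; _≈_ = RBCD-Iso
  ; isEquivalence = record
    { refl  = λ {D} → idₚ , com-refl next , com-refl (pair (diagram D))
                 , tr-refl (colour (diagram D)) , root-refl (root D)
    ; sym   = λ {D} {E} (f , a , b , c , d) →
                flip f , com-sym f next next a
                , com-sym f (pair (diagram D)) (pair (diagram E)) b
                , tr-sym f (colour (diagram D)) (colour (diagram E)) c
                , root-sym f (root D) (root E) d
    ; trans = λ {D} {E} {F} (f , a , b , c , d) (h , a' , b' , c' , d') →
                f ∘ₚ h , com-trans f h next next next a a'
                , com-trans f h (pair (diagram D)) (pair (diagram E)) (pair (diagram F)) b b'
                , tr-trans f h (colour (diagram D)) (colour (diagram E)) (colour (diagram F)) c c'
                , root-trans f h (root D) (root E) (root F) d d'
    }
  }

-- orbit relation of the group ⟨σ, α⟩ (generated by σ, σ⁻¹ and α; α is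
-- an involution)
data Reach {n : ℕ} (σ : Permutation′ n) (α : Fin n → Fin n) (b : Fin n) : Fin n → Set where
  here : Reach σ α b b
  stepσ  : ∀ {c} → Reach σ α b c → Reach σ α b (σ ⟨$⟩ʳ c)
  stepσ⁻ : ∀ {c} → Reach σ α b c → Reach σ α b (σ ⟨$⟩ˡ c)
  stepα  : ∀ {c} → Reach σ α b c → Reach σ α b (α c)

record Map (n : ℕ) : Set where
  field
    σ       : Permutation′ n
    α       : Fin n → Fin n
    α-invol : ∀ b → α (α b) ≡ b
    α-fpf   : ∀ b → α b ≢ b
    transitive : ∀ b b' → Reach σ α b b'
open Map public

-- A set F of edges is encoded by the set of flags of its edges, i.e. a
-- predicate on flags invariant under α.
-- Tour of F.
tour : {n : ℕ} → Map n → (Fin n → Bool) → Fin n → Fin n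
tour M F b = if F b then σ M ⟨$⟩ʳ α M b else σ M ⟨$⟩ʳ b

IsQuasiTree : {n : ℕ} → Map n → (Fin n → Bool) → Set
IsQuasiTree {n} M F = ∀ b b' → ∃ λ k → iter (tour M F) k b ≡ b'

record RootedMapQT (n : ℕ) : Set where
  field
    theMap   : Map n
    mroot    : Pt n
    S        : Fin n → Bool
    S-edges  : ∀ b → S (α theMap b) ≡ S b
    S-qtree  : IsQuasiTree theMap S
open RootedMapQT public

RMQ-Iso : {n : ℕ} → RootedMapQT n → RootedMapQT n → Set
RMQ-Iso {n} X Y = Σ (Permutation′ n) λ f →
  Commutes f (σ (theMap X) ⟨$⟩ʳ_) (σ (theMap Y) ⟨$⟩ʳ_) ×
  Commutes f (α (theMap X)) (α (theMap Y)) ×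
  RootRel (f ⟨$⟩ʳ_) (mroot X) (mroot Y) ×
  Transports f (S X) (S Y)

-- A map with m edges has exactly 2m flags.
RMQ-Setoid : ℕ → Setoid 0ℓ 0ℓ
RMQ-Setoid m = record
  { Carrier = RootedMapQT (2 * m)
  ; _≈_ = RMQ-Iso
  ; isEquivalence = record
    { refl  = λ {X} → idₚ , com-refl (σ (theMap X) ⟨$⟩ʳ_) , com-refl (α (theMap X))
                 , root-refl (mroot X) , tr-refl (S X)
    ; sym   = λ {X} {Y} (f , a , b , c , d) →
                flip f , com-sym f (σ (theMap X) ⟨$⟩ʳ_) (σ (theMap Y) ⟨$⟩ʳ_) a
                , com-sym f (α (theMap X)) (α (theMap Y)) b
                , root-sym f (mroot X) (mroot Y) c
                , tr-sym f (S X) (S Y) d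
    ; trans = λ {X} {Y} {Z} (f , a , b , c , d) (h , a' , b' , c' , d') →
                f ∘ₚ h
                , com-trans f h (σ (theMap X) ⟨$⟩ʳ_) (σ (theMap Y) ⟨$⟩ʳ_) (σ (theMap Z) ⟨$⟩ʳ_) a a'
                , com-trans f h (α (theMap X)) (α (theMap Y)) (α (theMap Z)) b b'
                , root-trans f h (mroot X) (mroot Y) (mroot Z) c c'
                , tr-trans f h (S X) (S Y) (S Z) d d'
    }
  }

-- Cutting the circle open at the root turns a rooted chord diagram into an ordered matching;
-- this is well defined and injective on isomorphism classes because a bijection of the points
-- that commutes with the cyclic successor and fixes one point is the identity.
--
-- An ordered matching becomes a map on the flags 0, …, 2m-1 with the chords as edges and
-- σ = next ∘ twist, where twist exchanges the endpoints of the chords of colour 2. The tour of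
-- these chords is σ ∘ twist = next, a single cycle, so they form a quasi-tree. Conversely, the
-- tour τ of a quasi-tree S is a single cycle through all flags, and labelling the flag τᵏ(root)
-- by k conjugates τ to next; in these labels α is a matching, S colours it, and the map is
-- recovered from the matching by the same formula σ = τ ∘ twist.
{-# OPTIONS --safe #-}
module Submission where

open import Defs
open import Data.Nat using (ℕ; zero; suc; _+_; _*_; _∸_; _%_; _/_; _≤_; _<_; NonZero; >-nonZero)
open import Data.Nat.Properties
  using (+-comm; m+[n∸m]≡n; m∸n+n≡m; m∸n≤m; m<n⇒0<n∸m; n<1+n; <⇒≤; <⇒≱; ≤-antisym; ≤-trans; ≤-pred;
         ≤-<-trans)
open import Data.Nat.DivMod
  using (m≡m%n+[m/n]*n; m%n<n; m<n⇒m%n≡m; %-distribˡ-+; m%n%n≡m%n; [m+n]%n≡m%n)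
open import Data.Fin using (Fin; zero; suc; toℕ; fromℕ<)
open import Data.Fin.Properties
  using (toℕ-fromℕ<; toℕ-injective; toℕ<n; pigeonhole; injective⇒≤; <-cmp)
open import Data.Fin.Permutation
  using (Permutation′; _⟨$⟩ʳ_; _⟨$⟩ˡ_; permutation; inverseˡ; inverseʳ; flip; _∘ₚ_)
  renaming (id to idₚ)
open import Data.Bool using (Bool; true; false; if_then_else_)
open import Data.Product using (∃; Σ; _×_; _,_; proj₁; proj₂)
open import Data.Unit using (tt)
open import Function using (_∘_)
open import Function.Bundles using (Bijection)
open import Function.Definitions using (Injective)
open import Function.Consequences.Setoid using (strictlySurjective⇒surjective)
open import Relation.Binary.Definitions using (tri<; tri≈; tri>)
open import Relation.Binary.PropositionalEquality
open import Data.Empty using (⊥-elim)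
open ≡-Reasoning

module _ {A : Set} where

  iter-+ : (f : A → A) (a b : ℕ) (x : A) → iter f (a + b) x ≡ iter f a (iter f b x)
  iter-+ f zero    b x = refl
  iter-+ f (suc a) b x = cong f (iter-+ f a b x)

  iter-commute : {f g : A → A} → (∀ x → g (f x) ≡ f (g x)) →
                 ∀ k x → g (iter f k x) ≡ iter f k (g x)
  iter-commute         gf zero    x = refl
  iter-commute {f} {g} gf (suc k) x = trans (gf _) (cong f (iter-commute gf k x))

  iter-cong : {f g : A → A} → (∀ x → f x ≡ g x) → ∀ k x → iter f k x ≡ iter g k x
  iter-cong         f≗g zero    x = refl
  iter-cong {f} {g} f≗g (suc k) x = trans (f≗g _) (cong g (iter-cong f≗g k x))

  iter-injective : {f : A → A} → Injective _≡_ _≡_ f → ∀ k → Injective _≡_ _≡_ (iter f k)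
  iter-injective f-inj zero    eq = eq
  iter-injective f-inj (suc k) eq = iter-injective f-inj k (f-inj eq)

  iter-*-fixed : {f : A → A} {x : A} (p : ℕ) → iter f p x ≡ x → ∀ q → iter f (q * p) x ≡ x
  iter-*-fixed         p fixed zero    = refl
  iter-*-fixed {f} {x} p fixed (suc q) = begin
    iter f (p + q * p) x        ≡⟨ iter-+ f p (q * p) x ⟩
    iter f p (iter f (q * p) x) ≡⟨ cong (iter f p) (iter-*-fixed p fixed q) ⟩
    iter f p x                  ≡⟨ fixed ⟩
    x                           ∎

  iter-% : {f : A → A} {x : A} (p : ℕ) .{{_ : NonZero p}} → iter f p x ≡ x →
           ∀ k → iter f (k % p) x ≡ iter f k x
  iter-% {f} {x} p fixed k = begin
    iter f (k % p) x                      ≡⟨ cong (iter f (k % p)) (sym (iter-*-fixed p fixed (k / p))) ⟩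
    iter f (k % p) (iter f (k / p * p) x) ≡⟨ sym (iter-+ f (k % p) (k / p * p) x) ⟩
    iter f (k % p + k / p * p) x          ≡⟨ cong (λ j → iter f j x) (sym (m≡m%n+[m/n]*n k p)) ⟩
    iter f k x                            ∎

SingleCycle : {n : ℕ} → (Fin n → Fin n) → Set
SingleCycle {n} τ = ∀ (b c : Fin n) → ∃ λ k → iter τ k b ≡ c

module Rotation (n : ℕ) where

  rotate : ℕ → Fin (suc n) → Fin (suc n)
  rotate = iter next

  toℕ-rotate : ∀ k → toℕ (rotate k zero) ≡ k % suc n
  toℕ-rotate zero    = refl
  toℕ-rotate (suc k) = begin
    toℕ (next (rotate k zero))              ≡⟨ toℕ-fromℕ< _ ⟩
    suc (toℕ (rotate k zero)) % suc n       ≡⟨ cong (λ j → suc j % suc n) (toℕ-rotate k) ⟩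
    (1 + k % suc n) % suc n                 ≡⟨ %-distribˡ-+ 1 (k % suc n) (suc n) ⟩
    (1 % suc n + k % suc n % suc n) % suc n ≡⟨ cong (λ j → (1 % suc n + j) % suc n)
                                                    (m%n%n≡m%n k (suc n)) ⟩
    (1 % suc n + k % suc n) % suc n         ≡⟨ sym (%-distribˡ-+ 1 k (suc n)) ⟩
    suc k % suc n                           ∎

  rotate-toℕ : ∀ i → rotate (toℕ i) zero ≡ i
  rotate-toℕ i = toℕ-injective (trans (toℕ-rotate (toℕ i)) (m<n⇒m%n≡m (toℕ<n i)))

  rotate-period : ∀ i → rotate (suc n) i ≡ i
  rotate-period i = begin
    rotate (suc n) i                    ≡⟨ cong (rotate (suc n)) (sym (rotate-toℕ i)) ⟩
    rotate (suc n) (rotate (toℕ i) zero) ≡⟨ sym (iter-+ next (suc n) (toℕ i) zero) ⟩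
    rotate (suc n + toℕ i) zero          ≡⟨ toℕ-injective (begin
      toℕ (rotate (suc n + toℕ i) zero)   ≡⟨ toℕ-rotate (suc n + toℕ i) ⟩
      (suc n + toℕ i) % suc n             ≡⟨ cong (_% suc n) (+-comm (suc n) (toℕ i)) ⟩
      (toℕ i + suc n) % suc n             ≡⟨ [m+n]%n≡m%n (toℕ i) (suc n) ⟩
      toℕ i % suc n                       ≡⟨ sym (toℕ-rotate (toℕ i)) ⟩
      toℕ (rotate (toℕ i) zero)           ∎) ⟩
    rotate (toℕ i) zero                  ≡⟨ rotate-toℕ i ⟩
    i                                    ∎

  rotate-inverse : ∀ a b → a + b ≡ suc n → ∀ i → rotate a (rotate b i) ≡ i
  rotate-inverse a b a+b≡n i =
    trans (sym (iter-+ next a b i)) (trans (cong (λ k → rotate k i) a+b≡n) (rotate-period i))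

  rotation : Fin (suc n) → Permutation′ (suc n)
  rotation r = permutation (rotate (toℕ r)) (rotate (suc n ∸ toℕ r))
    (rotate-inverse (toℕ r) (suc n ∸ toℕ r) (m+[n∸m]≡n (<⇒≤ (toℕ<n r))))
    (rotate-inverse (suc n ∸ toℕ r) (toℕ r) (m∸n+n≡m (<⇒≤ (toℕ<n r))))

  rotation-next : ∀ r → Commutes (rotation r) next next
  rotation-next r = iter-commute (λ _ → refl) (toℕ r)

  rigid : (g : Fin (suc n) → Fin (suc n)) → (∀ i → next (g i) ≡ g (next i)) →
          g zero ≡ zero → ∀ i → g i ≡ i
  rigid g g-next g-zero i = begin
    g i                        ≡⟨ cong g (sym (rotate-toℕ i)) ⟩
    g (rotate (toℕ i) zero)    ≡⟨ iter-commute (λ x → sym (g-next x)) (toℕ i) zero ⟩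
    rotate (toℕ i) (g zero)    ≡⟨ cong (rotate (toℕ i)) g-zero ⟩
    rotate (toℕ i) zero        ≡⟨ rotate-toℕ i ⟩
    i                          ∎

  next-singleCycle : SingleCycle next
  next-singleCycle b c = toℕ c + (suc n ∸ toℕ b) , (begin
    rotate (toℕ c + (suc n ∸ toℕ b)) b         ≡⟨ iter-+ next (toℕ c) (suc n ∸ toℕ b) b ⟩
    rotate (toℕ c) (rotate (suc n ∸ toℕ b) b)  ≡⟨ cong (rotate (toℕ c)) b↦zero ⟩
    rotate (toℕ c) zero                        ≡⟨ rotate-toℕ c ⟩
    c                                          ∎)
    where
      b↦zero : rotate (suc n ∸ toℕ b) b ≡ zero
      b↦zero = trans (cong (rotation b ⟨$⟩ˡ_) (sym (rotate-toℕ b))) (inverseˡ (rotation b))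

module CycleLabelling {n : ℕ} (τ : Fin (suc n) → Fin (suc n)) (τ-injective : Injective _≡_ _≡_ τ)
                      (r : Fin (suc n)) (reach : ∀ b → ∃ λ k → iter τ k r ≡ b) where

  orbit : ℕ → Fin (suc n)
  orbit k = iter τ k r

  orbit-return : ∀ {i j} → i ≤ j → orbit i ≡ orbit j → orbit (j ∸ i) ≡ r
  orbit-return {i} {j} i≤j eq = iter-injective τ-injective i (begin
    iter τ i (orbit (j ∸ i)) ≡⟨ sym (iter-+ τ i (j ∸ i) r) ⟩
    orbit (i + (j ∸ i))      ≡⟨ cong orbit (m+[n∸m]≡n i≤j) ⟩
    orbit j                  ≡⟨ sym eq ⟩
    orbit i                  ∎)

  -- If r returns after p steps, the orbit of r, which is everything, has at most p points.
  period-≥ : ∀ p .{{_ : NonZero p}} → orbit p ≡ r → suc n ≤ p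
  period-≥ p returns = injective⇒≤ index-injective
    where
      index : Fin (suc n) → Fin p
      index b = fromℕ< (m%n<n (proj₁ (reach b)) p)

      orbit-index : ∀ b → orbit (toℕ (index b)) ≡ b
      orbit-index b = trans (cong orbit (toℕ-fromℕ< (m%n<n (proj₁ (reach b)) p)))
                            (trans (iter-% p returns (proj₁ (reach b))) (proj₂ (reach b)))

      index-injective : Injective _≡_ _≡_ index
      index-injective {b} {c} eq =
        trans (sym (orbit-index b)) (trans (cong (orbit ∘ toℕ) eq) (orbit-index c))

  gap-≥ : ∀ {i j} → i < j → orbit i ≡ orbit j → suc n ≤ j ∸ i
  gap-≥ {i} {j} i<j eq =
    period-≥ (j ∸ i) {{>-nonZero (m<n⇒0<n∸m i<j)}} (orbit-return (<⇒≤ i<j) eq)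

  -- Two of orbit 0, …, orbit (suc n) coincide, and their gap is at most suc n.
  orbit-period : orbit (suc n) ≡ r
  orbit-period
    with i , j , i<j , eq ← pigeonhole (n<1+n (suc n)) (λ (k : Fin (suc (suc n))) → orbit (toℕ k))
    = subst (λ p → orbit p ≡ r) gap≡n (orbit-return (<⇒≤ i<j) eq)
    where
      gap≡n : toℕ j ∸ toℕ i ≡ suc n
      gap≡n = ≤-antisym (≤-trans (m∸n≤m (toℕ j) (toℕ i)) (≤-pred (toℕ<n j))) (gap-≥ i<j eq)

  label : Fin (suc n) → Fin (suc n)
  label i = orbit (toℕ i)

  label-next : ∀ i → τ (label i) ≡ label (next i)
  label-next i = begin
    orbit (suc (toℕ i))            ≡⟨ sym (iter-% (suc n) orbit-period (suc (toℕ i))) ⟩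
    orbit (suc (toℕ i) % suc n)    ≡⟨ cong orbit (sym (toℕ-fromℕ< (m%n<n (suc (toℕ i)) (suc n)))) ⟩
    label (next i)                 ∎

  label-surjective : ∀ b → ∃ λ i → label i ≡ b
  label-surjective b with k , reaches ← reach b =
    fromℕ< (m%n<n k (suc n)) ,
    trans (cong orbit (toℕ-fromℕ< (m%n<n k (suc n)))) (trans (iter-% (suc n) orbit-period k) reaches)

  label-<⇒≢ : ∀ {i j} → toℕ i < toℕ j → label i ≢ label j
  label-<⇒≢ {i} {j} i<j eq = <⇒≱ (≤-<-trans (m∸n≤m (toℕ j) (toℕ i)) (toℕ<n j)) (gap-≥ i<j eq)

  label-injective : Injective _≡_ _≡_ label
  label-injective {i} {j} eq with <-cmp i j
  ... | tri< i<j _ _ = ⊥-elim (label-<⇒≢ i<j eq)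
  ... | tri≈ _ i≡j _ = i≡j
  ... | tri> _ _ j<i = ⊥-elim (label-<⇒≢ j<i (sym eq))

  labelling : Permutation′ (suc n)
  labelling = permutation label (proj₁ ∘ label-surjective) (proj₂ ∘ label-surjective)
    (λ i → label-injective (proj₂ (label-surjective (label i))))

base : {n : ℕ} → Pt n
base {zero}  = tt
base {suc n} = zero

prev : {n : ℕ} → Fin n → Fin n
prev {suc n} = Rotation.rotate n n

next-prev : {n : ℕ} (i : Fin n) → next (prev i) ≡ i
next-prev {suc n} = Rotation.rotate-inverse n 1 n refl

prev-next : {n : ℕ} (i : Fin n) → prev (next i) ≡ i
prev-next {suc n} = Rotation.rotate-inverse n n 1 (+-comm n 1)

rotationTo : {n : ℕ} → Pt n → Permutation′ n
rotationTo {zero}  r = idₚ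
rotationTo {suc n} r = Rotation.rotation n r

rotationTo-next : {n : ℕ} (r : Pt n) → Commutes (rotationTo r) next next
rotationTo-next {zero}  r ()
rotationTo-next {suc n} r = Rotation.rotation-next n r

rotationTo-base : {n : ℕ} (r : Pt n) → RootRel (rotationTo r ⟨$⟩ʳ_) base r
rotationTo-base {zero}  r = tt
rotationTo-base {suc n} r = Rotation.rotate-toℕ n r

next-rigid : {n : ℕ} (g : Permutation′ n) → Commutes g next next → RootRel (g ⟨$⟩ʳ_) base base →
             ∀ i → g ⟨$⟩ʳ i ≡ i
next-rigid {zero}  g g-next g-base ()
next-rigid {suc n} g g-next g-base = Rotation.rigid n (g ⟨$⟩ʳ_) g-next g-base

next-singleCycle : {n : ℕ} → SingleCycle {n} next
next-singleCycle {zero}  ()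
next-singleCycle {suc n} = Rotation.next-singleCycle n

singleCycle⇒conjugate-next : {n : ℕ} (τ : Fin n → Fin n) → Injective _≡_ _≡_ τ → SingleCycle τ →
  (r : Pt n) → Σ (Permutation′ n) λ Φ → RootRel (Φ ⟨$⟩ʳ_) base r × Commutes Φ next τ
singleCycle⇒conjugate-next {zero}  τ τ-inj cycle r = idₚ , tt , λ ()
singleCycle⇒conjugate-next {suc n} τ τ-inj cycle r = labelling , refl , label-next
  where open CycleLabelling τ τ-inj r (cycle r)

module _ {n : ℕ} where

  _≈ᴹ_ : BMatching n → BMatching n → Set
  M ≈ᴹ N = (∀ i → pair M i ≡ pair N i) × (∀ i → colour M i ≡ colour N i)

  record MatchingIso (f : Permutation′ n) (M N : BMatching n) : Set where
    constructor matchingIso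
    field
      pair-iso   : Commutes f (pair M) (pair N)
      colour-iso : Transports f (colour M) (colour N)
  open MatchingIso public

  matchingIso-sym : ∀ {f M N} → MatchingIso f M N → MatchingIso (flip f) N M
  matchingIso-sym {f} {M} {N} (matchingIso f-pair f-colour) =
    matchingIso (com-sym f (pair M) (pair N) f-pair) (tr-sym f (colour M) (colour N) f-colour)

  matchingIso-trans : ∀ {f h M N K} → MatchingIso f M N → MatchingIso h N K → MatchingIso (f ∘ₚ h) M K
  matchingIso-trans {f} {h} {M} {N} {K} (matchingIso f-pair f-colour) (matchingIso h-pair h-colour) =
    matchingIso (com-trans f h (pair M) (pair N) (pair K) f-pair h-pair)
                (tr-trans f h (colour M) (colour N) (colour K) f-colour h-colour)

  ≈⇒matchingIso : ∀ {M N} → M ≈ᴹ N → MatchingIso idₚ M N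
  ≈⇒matchingIso (same-pair , same-colour) =
    matchingIso (λ i → sym (same-pair i)) (λ i → sym (same-colour i))

  matchingIso⇒≈ : ∀ {f M N} → (∀ i → f ⟨$⟩ʳ i ≡ i) → MatchingIso f M N → M ≈ᴹ N
  matchingIso⇒≈ {f} {M} {N} f≗id (matchingIso f-pair f-colour) =
    (λ i → trans (sym (f≗id _)) (trans (sym (f-pair i)) (cong (pair N) (f≗id i)))) ,
    (λ i → trans (sym (f-colour i)) (cong (colour N) (f≗id i)))

  pullback : Permutation′ n → BMatching n → BMatching n
  pullback f N = record
    { pair         = λ i → f ⟨$⟩ˡ pair N (f ⟨$⟩ʳ i)
    ; pair-invol   = λ i → begin
        f ⟨$⟩ˡ pair N (f ⟨$⟩ʳ (f ⟨$⟩ˡ pair N (f ⟨$⟩ʳ i))) ≡⟨ cong (λ j → f ⟨$⟩ˡ pair N j) (inverseʳ f) ⟩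
        f ⟨$⟩ˡ pair N (pair N (f ⟨$⟩ʳ i))                 ≡⟨ cong (f ⟨$⟩ˡ_) (pair-invol N _) ⟩
        f ⟨$⟩ˡ (f ⟨$⟩ʳ i)                                 ≡⟨ inverseˡ f ⟩
        i                                                 ∎
    ; pair-fpf     = λ i fixed →
        pair-fpf N (f ⟨$⟩ʳ i) (trans (sym (inverseʳ f)) (cong (f ⟨$⟩ʳ_) fixed))
    ; colour       = λ i → colour N (f ⟨$⟩ʳ i)
    ; colour-chord = λ i → trans (cong (colour N) (inverseʳ f)) (colour-chord N _)
    }

  pullback-iso : ∀ f N → MatchingIso f (pullback f N) N
  pullback-iso f N = matchingIso (λ i → sym (inverseʳ f)) (λ i → refl)

cutAtRoot : {n : ℕ} → RBCD n → BMatching n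
cutAtRoot D = pullback (rotationTo (root D)) (diagram D)

cutAtRoot-cong : {n : ℕ} {D E : RBCD n} → RBCD-Iso D E → cutAtRoot D ≈ᴹ cutAtRoot E
cutAtRoot-cong {D = D} {E} (f , f-next , f-pair , f-colour , f-root) =
  matchingIso⇒≈ (next-rigid h h-next h-base) h-iso
  where
    Rᴰ = rotationTo (root D)
    Rᴱ = rotationTo (root E)
    h = Rᴰ ∘ₚ f ∘ₚ flip Rᴱ
    h-next : Commutes h next next
    h-next = com-trans Rᴰ (f ∘ₚ flip Rᴱ) next next next (rotationTo-next (root D))
               (com-trans f (flip Rᴱ) next next next f-next
                 (com-sym Rᴱ next next (rotationTo-next (root E))))
    h-base : RootRel (h ⟨$⟩ʳ_) base base
    h-base = root-trans Rᴰ (f ∘ₚ flip Rᴱ) base (root D) base (rotationTo-base (root D))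
               (root-trans f (flip Rᴱ) (root D) (root E) base f-root
                 (root-sym Rᴱ base (root E) (rotationTo-base (root E))))
    h-iso : MatchingIso h (cutAtRoot D) (cutAtRoot E)
    h-iso = matchingIso-trans (pullback-iso Rᴰ (diagram D))
              (matchingIso-trans (matchingIso {f = f} f-pair f-colour)
                (matchingIso-sym (pullback-iso Rᴱ (diagram E))))

cutAtRoot-injective : {n : ℕ} {D E : RBCD n} → cutAtRoot D ≈ᴹ cutAtRoot E → RBCD-Iso D E
cutAtRoot-injective {D = D} {E} cuts≈ = f , f-next , pair-iso f-iso , colour-iso f-iso , f-root
  where
    Rᴰ = rotationTo (root D)
    Rᴱ = rotationTo (root E)
    f = flip Rᴰ ∘ₚ idₚ ∘ₚ Rᴱ
    f-next : Commutes f next next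
    f-next = com-trans (flip Rᴰ) (idₚ ∘ₚ Rᴱ) next next next
               (com-sym Rᴰ next next (rotationTo-next (root D)))
               (com-trans idₚ Rᴱ next next next (com-refl next) (rotationTo-next (root E)))
    f-root : RootRel (f ⟨$⟩ʳ_) (root D) (root E)
    f-root = root-trans (flip Rᴰ) (idₚ ∘ₚ Rᴱ) (root D) base (root E)
               (root-sym Rᴰ base (root D) (rotationTo-base (root D)))
               (root-trans idₚ Rᴱ base base (root E) (root-refl base) (rotationTo-base (root E)))
    f-iso : MatchingIso f (diagram D) (diagram E)
    f-iso = matchingIso-trans (matchingIso-sym (pullback-iso Rᴰ (diagram D)))
              (matchingIso-trans (≈⇒matchingIso cuts≈) (pullback-iso Rᴱ (diagram E)))

cutAtRoot-strictlySurjective : {n : ℕ} (M : BMatching n) → ∃ λ D → cutAtRoot D ≈ᴹ M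
cutAtRoot-strictlySurjective M =
  record { diagram = M ; root = base } ,
  matchingIso⇒≈ (next-rigid (rotationTo base) (rotationTo-next base) (rotationTo-base base))
                (pullback-iso (rotationTo base) M)

-- The chords of colour 2 are the edges of the quasi-tree.
toBool : Colour → Bool
toBool zero       = false
toBool (suc zero) = true

fromBool : Bool → Colour
fromBool false = zero
fromBool true  = suc zero

toBool-fromBool : ∀ s → toBool (fromBool s) ≡ s
toBool-fromBool false = refl
toBool-fromBool true  = refl

fromBool-toBool : ∀ c → fromBool (toBool c) ≡ c
fromBool-toBool zero       = refl
fromBool-toBool (suc zero) = refl

toBool-injective : Injective _≡_ _≡_ toBool
toBool-injective {c} {c′} eq =
  trans (sym (fromBool-toBool c)) (trans (cong fromBool eq) (fromBool-toBool c′))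

module _ {n : ℕ} where

  twist : BMatching n → Fin n → Fin n
  twist M b = if toBool (colour M b) then pair M b else b

  twist-elim : (M : BMatching n) (b : Fin n) (P : Fin n → Set) → P b → P (pair M b) → P (twist M b)
  twist-elim M b P Pb Ppair with toBool (colour M b)
  ... | true  = Ppair
  ... | false = Pb

  twist-involutive : (M : BMatching n) (b : Fin n) → twist M (twist M b) ≡ b
  twist-involutive M b with toBool (colour M b) in chosen
  ... | true  rewrite colour-chord M b | chosen = pair-invol M b
  ... | false rewrite chosen = refl

  twist-iso : ∀ {f M N} → MatchingIso f M N → Commutes f (twist M) (twist N)
  twist-iso {f} {M} {N} (matchingIso f-pair f-colour) i rewrite f-colour i with toBool (colour M i)
  ... | true  = f-pair i
  ... | false = refl

  edgeMatching : (X : Map n) (S : Fin n → Bool) → (∀ b → S (α X b) ≡ S b) → BMatching n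
  edgeMatching X S S-edges = record
    { pair         = α X
    ; pair-invol   = α-invol X
    ; pair-fpf     = α-fpf X
    ; colour       = fromBool ∘ S
    ; colour-chord = cong fromBool ∘ S-edges
    }

  tour-twist : (X : Map n) (S : Fin n → Bool) (S-edges : ∀ b → S (α X b) ≡ S b) →
               ∀ b → tour X S b ≡ σ X ⟨$⟩ʳ twist (edgeMatching X S S-edges) b
  tour-twist X S S-edges b with S b
  ... | true  = refl
  ... | false = refl

  tour-injective : (X : Map n) (S : Fin n → Bool) → (∀ b → S (α X b) ≡ S b) →
                   Injective _≡_ _≡_ (tour X S)
  tour-injective X S S-edges {b} {c} eq = begin
    b                                ≡⟨ sym (twist-involutive E b) ⟩
    twist E (twist E b)              ≡⟨ cong (twist E) (σ-injective (begin
      σ X ⟨$⟩ʳ twist E b               ≡⟨ sym (tour-twist X S S-edges b) ⟩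
      tour X S b                       ≡⟨ eq ⟩
      tour X S c                       ≡⟨ tour-twist X S S-edges c ⟩
      σ X ⟨$⟩ʳ twist E c               ∎)) ⟩
    twist E (twist E c)              ≡⟨ twist-involutive E c ⟩
    c                                ∎
    where
      E = edgeMatching X S S-edges
      σ-injective : Injective _≡_ _≡_ (σ X ⟨$⟩ʳ_)
      σ-injective eq′ = trans (sym (inverseˡ (σ X))) (trans (cong (σ X ⟨$⟩ˡ_) eq′) (inverseˡ (σ X)))

  tour-commute : (X Y : RootedMapQT n) (iso : RMQ-Iso X Y) →
                 Commutes (proj₁ iso) (tour (theMap X) (S X)) (tour (theMap Y) (S Y))
  tour-commute X Y (f , f-σ , f-α , _ , f-S) i rewrite f-S i with S X i
  ... | true  = trans (cong (σ (theMap Y) ⟨$⟩ʳ_) (f-α i)) (f-σ (α (theMap X) i))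
  ... | false = f-σ i

  circleMap : BMatching n → Map n
  circleMap M = record
    { σ          = σᴹ
    ; α          = pair M
    ; α-invol    = pair-invol M
    ; α-fpf      = pair-fpf M
    ; transitive = λ b c → subst (Reach σᴹ (pair M) b) (proj₂ (next-singleCycle b c))
                             (reach-iter (proj₁ (next-singleCycle b c)))
    }
    where
      σᴹ : Permutation′ n
      σᴹ = permutation (next ∘ twist M) (twist M ∘ prev)
             (λ c → trans (cong next (twist-involutive M (prev c))) (next-prev c))
             (λ b → trans (cong (twist M) (prev-next (twist M b))) (twist-involutive M b))
      reach-next : ∀ {b c} → Reach σᴹ (pair M) b c → Reach σᴹ (pair M) b (next c)
      reach-next {b} {c} r = subst (Reach σᴹ (pair M) b) (cong next (twist-involutive M c))
                               (stepσ (twist-elim M c (Reach σᴹ (pair M) b) r (stepα r)))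
      reach-iter : ∀ {b} k → Reach σᴹ (pair M) b (iter next k b)
      reach-iter zero    = here
      reach-iter (suc k) = reach-next (reach-iter k)

  circleMap-tour : (M : BMatching n) (b : Fin n) → tour (circleMap M) (toBool ∘ colour M) b ≡ next b
  circleMap-tour M b = begin
    tour (circleMap M) Sᴹ b         ≡⟨ tour-twist (circleMap M) Sᴹ Sᴹ-edges b ⟩
    next (twist M (twist E b))      ≡⟨ cong (next ∘ twist M) (twist-iso {f = idₚ} M≅E b) ⟩
    next (twist M (twist M b))      ≡⟨ cong next (twist-involutive M b) ⟩
    next b                          ∎
    where
      Sᴹ = toBool ∘ colour M
      Sᴹ-edges = cong toBool ∘ colour-chord M
      E = edgeMatching (circleMap M) Sᴹ Sᴹ-edges
      M≅E : MatchingIso idₚ M E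
      M≅E = matchingIso (λ i → refl) (λ i → fromBool-toBool (colour M i))

toRootedMap : {n : ℕ} → BMatching n → RootedMapQT n
toRootedMap M = record
  { theMap  = circleMap M
  ; mroot   = base
  ; S       = toBool ∘ colour M
  ; S-edges = cong toBool ∘ colour-chord M
  ; S-qtree = λ b c → let k , reaches = next-singleCycle b c
                      in k , trans (iter-cong (circleMap-tour M) k b) reaches
  }

toRootedMap-cong : {n : ℕ} {M N : BMatching n} → M ≈ᴹ N → RMQ-Iso (toRootedMap M) (toRootedMap N)
toRootedMap-cong {M = M} {N} M≈N =
  idₚ , (λ i → cong next (twist-iso M≅N i)) , pair-iso M≅N , root-refl base ,
  (λ i → cong toBool (colour-iso M≅N i))
  where
    M≅N : MatchingIso idₚ M N
    M≅N = ≈⇒matchingIso M≈N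

toRootedMap-injective : {n : ℕ} {M N : BMatching n} → RMQ-Iso (toRootedMap M) (toRootedMap N) → M ≈ᴹ N
toRootedMap-injective {M = M} {N} iso@(f , _ , f-α , f-root , f-S) =
  matchingIso⇒≈ {f = f} {M} {N} (next-rigid f f-next f-root)
                (matchingIso f-α (λ i → toBool-injective (f-S i)))
  where
    f-next : Commutes f next next
    f-next i = begin
      next (f ⟨$⟩ʳ i)                                   ≡⟨ sym (circleMap-tour N (f ⟨$⟩ʳ i)) ⟩
      tour (circleMap N) (toBool ∘ colour N) (f ⟨$⟩ʳ i) ≡⟨ tour-commute (toRootedMap M) (toRootedMap N) iso i ⟩
      f ⟨$⟩ʳ tour (circleMap M) (toBool ∘ colour M) i   ≡⟨ cong (f ⟨$⟩ʳ_) (circleMap-tour M i) ⟩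
      f ⟨$⟩ʳ next i                                     ∎

toRootedMap-strictlySurjective : {n : ℕ} (X : RootedMapQT n) → ∃ λ M → RMQ-Iso (toRootedMap M) X
toRootedMap-strictlySurjective X = M , Φ , Φ-σ , pair-iso M≅E , Φ-root , Φ-S
  where
    τ = tour (theMap X) (S X)
    E = edgeMatching (theMap X) (S X) (S-edges X)
    conjugacy = singleCycle⇒conjugate-next τ (tour-injective (theMap X) (S X) (S-edges X))
                  (S-qtree X) (mroot X)
    Φ = proj₁ conjugacy
    Φ-root = proj₁ (proj₂ conjugacy)
    Φ-next = proj₂ (proj₂ conjugacy)
    M = pullback Φ E
    M≅E = pullback-iso Φ E
    Φ-σ : Commutes Φ (σ (circleMap M) ⟨$⟩ʳ_) (σ (theMap X) ⟨$⟩ʳ_)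
    Φ-σ i = begin
      σ (theMap X) ⟨$⟩ʳ (Φ ⟨$⟩ʳ i)                   ≡⟨ cong (σ (theMap X) ⟨$⟩ʳ_) (sym (twist-involutive E _)) ⟩
      σ (theMap X) ⟨$⟩ʳ twist E (twist E (Φ ⟨$⟩ʳ i)) ≡⟨ sym (tour-twist (theMap X) (S X) (S-edges X) _) ⟩
      τ (twist E (Φ ⟨$⟩ʳ i))                          ≡⟨ cong τ (twist-iso M≅E i) ⟩
      τ (Φ ⟨$⟩ʳ twist M i)                            ≡⟨ Φ-next (twist M i) ⟩
      Φ ⟨$⟩ʳ next (twist M i)                         ∎
    Φ-S : Transports Φ (toBool ∘ colour M) (S X)
    Φ-S i = sym (toBool-fromBool (S X (Φ ⟨$⟩ʳ i)))

cutAtRoot-bijection : (m : ℕ) → Bijection (RBCD-Setoid m) (BOM-Setoid m)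
cutAtRoot-bijection m = record
  { to        = cutAtRoot
  ; cong      = λ {D} {E} → cutAtRoot-cong {D = D} {E}
  ; bijective = (λ {D} {E} → cutAtRoot-injective {D = D} {E}) ,
                strictlySurjective⇒surjective (RBCD-Setoid m) (BOM-Setoid m) {f = cutAtRoot}
                  (λ {D} {E} → cutAtRoot-cong {D = D} {E}) cutAtRoot-strictlySurjective
  }

toRootedMap-bijection : (m : ℕ) → Bijection (BOM-Setoid m) (RMQ-Setoid m)
toRootedMap-bijection m = record
  { to        = toRootedMap
  ; cong      = λ {M} {N} → toRootedMap-cong {M = M} {N}
  ; bijective = (λ {M} {N} → toRootedMap-injective {M = M} {N}) ,
                strictlySurjective⇒surjective (BOM-Setoid m) (RMQ-Setoid m) {f = toRootedMap}
                  (λ {M} {N} → toRootedMap-cong {M = M} {N}) toRootedMap-strictlySurjective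
  }

lemma12 : (m : ℕ) →
    Bijection (RBCD-Setoid m) (BOM-Setoid m) × Bijection (BOM-Setoid m) (RMQ-Setoid m)
lemma12 m = cutAtRoot-bijection m , toRootedMap-bijection m
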